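{- There exist a strongly connected digraph $D$ and a strongly connected spanning subdigraph $H$ of $D$ such that $src^*(D) > src^*(H)$.
   Context: All digraphs are finite, without loops or multiple arcs. Let $D$ be a strongly connected digraph. For an arc-colouring of $D$, a directed path is rainbow if no two of its arcs receive the same colour. An arc-colouring is strongly rainbow connected if for every ordered pair of distinct vertices $x,y$ there is a rainbow directed $xy$-path whose length equals the directed distance $d_D(x,y)$ (a rainbow $xy$-geodesic). The strong rainbow connection number $src^*(D)$ is the minimum number of colours in a strongly rainbow connected arc-colouring of $D$. A spanning subdigraph of $D$ has the same vertex set as $D$ and a subset of its arcs. -}

module Defs where

open import Data.Nat using (ℕ; zero; suc; _≤_; _<_)
open import Data.Fin using (Fin)
open import Data.Bool using (Bool; true; false)
open import Data.List using (List; []; _∷_)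
open import Data.List.Relation.Unary.Unique.Propositional using (Unique)
open import Data.Product using (Σ; _×_)
open import Relation.Binary.PropositionalEquality using (_≡_; _≢_)

record Digraph (n : ℕ) : Set where
  field
    adj      : Fin n → Fin n → Bool
    loopless : ∀ x → adj x x ≡ false
open Digraph public

Arc : ∀ {n} → Digraph n → Fin n → Fin n → Set
Arc D x y = adj D x y ≡ true

data Walk {n} (D : Digraph n) : Fin n → Fin n → Set where
  nil  : ∀ {x} → Walk D x x
  cons : ∀ {x y z} → Arc D x y → Walk D y z → Walk D x z

len : ∀ {n} {D : Digraph n} {x y} → Walk D x y → ℕ
len nil        = zero
len (cons _ w) = suc (len w)

StronglyConnected : ∀ {n} → Digraph n → Set
StronglyConnected D = ∀ x y → Walk D x y

SpanningSubdigraph : ∀ {n} → Digraph n → Digraph n → Set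
SpanningSubdigraph H D = ∀ x y → Arc H x y → Arc D x y

-- an arc-colouring with (at most) k colours; values on non-arcs are irrelevant
ArcColouring : ℕ → ℕ → Set
ArcColouring n k = Fin n → Fin n → Fin k

colours : ∀ {n k} {D : Digraph n} {x y} → ArcColouring n k → Walk D x y → List (Fin k)
colours c nil                     = []
colours c (cons {x} {y} _ w)      = c x y ∷ colours c w

Rainbow : ∀ {n k} {D : Digraph n} {x y} → ArcColouring n k → Walk D x y → Set
Rainbow c w = Unique (colours c w)

-- a geodesic: an xy-walk of length d_D(x,y), i.e. of minimum length
-- (such a walk is necessarily a directed path)
Geodesic : ∀ {n} {D : Digraph n} {x y} → Walk D x y → Set
Geodesic {D = D} {x} {y} w = (w' : Walk D x y) → len w ≤ len w'

StronglyRainbowConnected : ∀ {n k} → Digraph n → ArcColouring n k → Set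
StronglyRainbowConnected D c =
  ∀ x y → x ≢ y → Σ (Walk D x y) (λ w → Geodesic w × Rainbow c w)

IsSrc : ∀ {n} → Digraph n → ℕ → Set
IsSrc {n} D k =
  Σ (ArcColouring n k) (StronglyRainbowConnected D)
  × (∀ j (c : ArcColouring n j) → StronglyRainbowConnected D c → k ≤ j)

module Submission where

-- H has seven vertices and D = H + (4 → 5). In both, 2 → 1 → 4 → 6 is the only geodesic
-- from 2 to 6, so at least three colours are needed; explicit colourings with three colours
-- for H and four for D are checked by enumerating all geodesics. Three colours fail for D:
-- a21, a14, a46 are then all the colours, the geodesic 5 → 1 → 4 → 6 forces a51 = a21, and
-- 1 → 4 → 5, 4 → 5 → 1 force a45 = a46. Now the geodesic 6 → 2 → 1 → 4 could only be rainbow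
-- with a62 = a46, clashing with 4 → 6 → 2, and 6 → 3 → 0 → 4 only with a04 = a46 = a45,
-- clashing with 0 → 4 → 5.

open import Defs
open import Axiom.UniquenessOfIdentityProofs using (module Decidable⇒UIP)
open import Data.Bool using (Bool; true; false; _∨_)
import Data.Bool.Properties as Bool
open import Data.Empty using (⊥; ⊥-elim)
open import Data.Fin using (Fin; zero; suc)
open import Data.Fin.Properties using (_≟_; all?; injective⇒≤)
open import Data.List using (List; []; _∷_; length; lookup; concatMap; map; allFin)
open import Data.List.Membership.Propositional using (_∈_; find; lose)
open import Data.List.Membership.Propositional.Properties
  using (∈-map⁺; ∈-map⁻; ∈-concatMap⁺; ∈-concatMap⁻; ∈-allFin; ∈-lookup)
open import Data.List.Relation.Unary.All as All using ([]; _∷_)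
open import Data.List.Relation.Unary.All.Properties using (¬Any⇒All¬)
open import Data.List.Relation.Unary.AllPairs using (_∷_)
open import Data.List.Relation.Unary.Any as Any using (Any; here; there; any?)
open import Data.List.Relation.Unary.Unique.Propositional using (Unique)
import Data.List.Relation.Unary.Unique.DecPropositional as UniqueDec
open import Data.Nat using (ℕ; zero; suc; _≤_; _<_; z≤n)
open import Data.Nat.Properties using (≤-trans; ≤-antisym; ≤-refl; 1+n≰n; m≤n⇒m<n∨m≡n)
open import Data.Product using (Σ; _×_; _,_; proj₁; proj₂)
open import Data.Sum using (_⊎_; inj₁; inj₂)
open import Function.Definitions using (Injective)
open import Relation.Nullary using (¬_; Dec; yes; no)
open import Relation.Nullary.Decidable using (¬?; _→-dec_; from-yes)
open import Relation.Binary.PropositionalEquality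
  using (_≡_; _≢_; refl; sym; trans; cong; subst)

private
  variable
    n k : ℕ

unique⇒lookup-injective : {xs : List (Fin k)} → Unique xs → Injective _≡_ _≡_ (lookup xs)
unique⇒lookup-injective (_ ∷ u) {zero} {zero} _ = refl
unique⇒lookup-injective (x∉xs ∷ _) {zero} {suc j} eq = ⊥-elim (All.lookup x∉xs (∈-lookup j) eq)
unique⇒lookup-injective (x∉xs ∷ _) {suc i} {zero} eq = ⊥-elim (All.lookup x∉xs (∈-lookup i) (sym eq))
unique⇒lookup-injective (_ ∷ u) {suc i} {suc j} eq = cong suc (unique⇒lookup-injective u eq)

unique⇒length≤ : {xs : List (Fin k)} → Unique xs → length xs ≤ k
unique⇒length≤ u = injective⇒≤ (unique⇒lookup-injective u)

unique-full⇒∈ : {xs : List (Fin k)} → Unique xs → length xs ≡ k → (d : Fin k) → d ∈ xs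
unique-full⇒∈ {xs = xs} u full d with any? (d ≟_) xs
... | yes d∈xs = d∈xs
... | no d∉xs = ⊥-elim (1+n≰n (subst (λ m → suc m ≤ _) full
                  (unique⇒length≤ (¬Any⇒All¬ xs d∉xs ∷ u))))

module _ (D : Digraph n) where

  mutual
    walksOfLength : ℕ → (x y : Fin n) → List (Walk D x y)
    walksOfLength zero x y with x ≟ y
    ... | yes refl = nil ∷ []
    ... | no _ = []
    walksOfLength (suc k) x y = concatMap (walksThrough k x y) (allFin n)

    walksThrough : ℕ → (x y z : Fin n) → List (Walk D x y)
    walksThrough k x y z with adj D x z Bool.≟ true
    ... | yes x→z = map (cons x→z) (walksOfLength k z y)
    ... | no _ = []

  mutual
    len-walksOfLength : ∀ {k x y} {w : Walk D x y} → w ∈ walksOfLength k x y → len w ≡ k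
    len-walksOfLength {zero} {x} {y} w∈ with x ≟ y
    len-walksOfLength {zero} (here refl) | yes refl = refl
    len-walksOfLength {suc k} {x} {y} w∈ =
      len-walksThrough (proj₂ (Any.satisfied (∈-concatMap⁻ (walksThrough k x y) {xs = allFin n} w∈)))

    len-walksThrough : ∀ {k x y z} {w : Walk D x y} → w ∈ walksThrough k x y z → len w ≡ suc k
    len-walksThrough {k} {x} {y} {z} w∈ with adj D x z Bool.≟ true
    ... | yes x→z with ∈-map⁻ (cons x→z) w∈
    ...   | _ , w′∈ , refl = cong suc (len-walksOfLength w′∈)
    len-walksThrough () | no _

  walk-∈-walksOfLength : ∀ {x y} (w : Walk D x y) → w ∈ walksOfLength (len w) x y
  walk-∈-walksOfLength {x} nil with x ≟ x
  ... | yes refl = here refl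
  ... | no x≢x = ⊥-elim (x≢x refl)
  walk-∈-walksOfLength {x} {y} (cons {y = z} x→z w) =
    ∈-concatMap⁺ (walksThrough (len w) x y) (Any.map (λ { refl → ∈-walksThrough }) (∈-allFin z))
    where
    ∈-walksThrough : cons x→z w ∈ walksThrough (len w) x y z
    ∈-walksThrough with adj D x z Bool.≟ true
    ... | yes x→z′ rewrite Decidable⇒UIP.≡-irrelevant Bool._≟_ x→z x→z′ =
          ∈-map⁺ (cons x→z′) (walk-∈-walksOfLength w)
    ... | no ¬x→z = ⊥-elim (¬x→z x→z)

  NoWalkShorterThan : ℕ → (x y : Fin n) → Set
  NoWalkShorterThan m x y = (w : Walk D x y) → m ≤ len w

  noWalkShorterThan-suc : ∀ {m x y} → NoWalkShorterThan m x y → walksOfLength m x y ≡ [] →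
                          NoWalkShorterThan (suc m) x y
  noWalkShorterThan-suc {m} noShorter empty w with m≤n⇒m<n∨m≡n (noShorter w)
  ... | inj₁ m<len = m<len
  ... | inj₂ refl with subst (w ∈_) empty (walk-∈-walksOfLength w)
  ...   | ()

  geodesicsFrom : (fuel m : ℕ) (x y : Fin n) → List (Walk D x y)
  geodesicsFrom zero m x y = []
  geodesicsFrom (suc fuel) m x y with walksOfLength m x y
  ... | [] = geodesicsFrom fuel (suc m) x y
  ... | ws@(_ ∷ _) = ws

  -- Were the fuel n exhausted the list would be empty; completeness is therefore stated
  -- relative to a known member w′ rather than by showing that n always suffices.
  geodesics : (x y : Fin n) → List (Walk D x y)
  geodesics = geodesicsFrom n zero

  geodesicsFrom-geodesic : ∀ fuel {m x y} {w : Walk D x y} → NoWalkShorterThan m x y →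
                           w ∈ geodesicsFrom fuel m x y → Geodesic w
  geodesicsFrom-geodesic (suc fuel) {m} {x} {y} {w} noShorter w∈ with walksOfLength m x y in eq
  ... | [] = geodesicsFrom-geodesic fuel (noWalkShorterThan-suc noShorter eq) w∈
  ... | _ ∷ _ = λ w′ → subst (_≤ len w′) (sym len-w≡m) (noShorter w′)
    where
    len-w≡m : len w ≡ m
    len-w≡m = len-walksOfLength (subst (w ∈_) (sym eq) w∈)

  geodesic-∈-geodesicsFrom : ∀ fuel {m x y} {w w′ : Walk D x y} → NoWalkShorterThan m x y →
                             Geodesic w → w′ ∈ geodesicsFrom fuel m x y → w ∈ geodesicsFrom fuel m x y
  geodesic-∈-geodesicsFrom (suc fuel) {m} {x} {y} {w} {w′} noShorter geo w′∈
    with walksOfLength m x y in eq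
  ... | [] = geodesic-∈-geodesicsFrom fuel (noWalkShorterThan-suc noShorter eq) geo w′∈
  ... | _ ∷ _ =
    subst (w ∈_) eq (subst (λ l → w ∈ walksOfLength l x y) len-w≡m (walk-∈-walksOfLength w))
    where
    len-w≡m : len w ≡ m
    len-w≡m = ≤-antisym (subst (len w ≤_) (len-walksOfLength (subst (w′ ∈_) (sym eq) w′∈)) (geo w′))
                        (noShorter w)

  geodesics-geodesic : ∀ {x y} {w : Walk D x y} → w ∈ geodesics x y → Geodesic w
  geodesics-geodesic = geodesicsFrom-geodesic n (λ _ → z≤n)

  geodesic-∈-geodesics : ∀ {x y} {w w′ : Walk D x y} → Geodesic w → w′ ∈ geodesics x y →
                         w ∈ geodesics x y
  geodesic-∈-geodesics = geodesic-∈-geodesicsFrom n (λ _ → z≤n)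

  module _ {k} (c : ArcColouring n k) where

    RainbowGeodesicsEverywhere : Set
    RainbowGeodesicsEverywhere = ∀ x y → x ≢ y → Any (Rainbow c) (geodesics x y)

    rainbowGeodesicsEverywhere? : Dec RainbowGeodesicsEverywhere
    rainbowGeodesicsEverywhere? =
      all? λ x → all? λ y →
        ¬? (x ≟ y) →-dec any? (λ w → UniqueDec.unique? _≟_ (colours c w)) (geodesics x y)

    rainbowGeodesicsEverywhere⇒src : RainbowGeodesicsEverywhere → StronglyRainbowConnected D c
    rainbowGeodesicsEverywhere⇒src everywhere x y x≢y with find (everywhere x y x≢y)
    ... | w , w∈ , rainbow = w , geodesics-geodesic w∈ , rainbow

    module _ (src : StronglyRainbowConnected D c) where

      src⇒stronglyConnected : StronglyConnected D
      src⇒stronglyConnected x y with x ≟ y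
      ... | yes refl = nil
      ... | no x≢y = proj₁ (src x y x≢y)

      src⇒rainbowGeodesic : ∀ {x y} {w : Walk D x y} {ws} → x ≢ y → geodesics x y ≡ w ∷ ws →
                            Any (Rainbow c) (w ∷ ws)
      src⇒rainbowGeodesic {x} {y} {w} x≢y eq with src x y x≢y
      ... | w′ , geodesic , rainbow = lose (subst (w′ ∈_) eq w′∈) rainbow
        where
        w′∈ : w′ ∈ geodesics x y
        w′∈ = geodesic-∈-geodesics geodesic (subst (w ∈_) (sym eq) (here refl))

      src⇒uniqueGeodesic-rainbow : ∀ {x y} {w : Walk D x y} → x ≢ y → geodesics x y ≡ w ∷ [] →
                                   Rainbow c w
      src⇒uniqueGeodesic-rainbow x≢y eq with src⇒rainbowGeodesic x≢y eq
      ... | here rainbow = rainbow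

      src⇒geodesic-len≤ : ∀ {x y} {w : Walk D x y} → x ≢ y → Geodesic w → len w ≤ k
      src⇒geodesic-len≤ {x} {y} {w} x≢y geodesic with src x y x≢y
      ... | w′ , _ , rainbow =
        ≤-trans (geodesic w′) (subst (_≤ k) (length-colours w′) (unique⇒length≤ rainbow))
        where
        length-colours : ∀ {x y} (w : Walk D x y) → length (colours c w) ≡ len w
        length-colours nil = refl
        length-colours (cons _ w) = cong suc (length-colours w)

pattern v0 = zero
pattern v1 = suc v0
pattern v2 = suc v1
pattern v3 = suc v2
pattern v4 = suc v3
pattern v5 = suc v4
pattern v6 = suc v5

arcsH : Fin 7 → Fin 7 → Bool
arcsH v0 v3 = true
arcsH v0 v4 = true
arcsH v0 v6 = true
arcsH v1 v3 = true
arcsH v1 v4 = true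
arcsH v2 v1 = true
arcsH v2 v5 = true
arcsH v3 v0 = true
arcsH v3 v2 = true
arcsH v4 v6 = true
arcsH v5 v1 = true
arcsH v6 v2 = true
arcsH v6 v3 = true
arcsH _ _ = false

isArc45 : Fin 7 → Fin 7 → Bool
isArc45 v4 v5 = true
isArc45 _ _ = false

H : Digraph 7
H = record
  { adj = arcsH
  ; loopless = λ { v0 → refl ; v1 → refl ; v2 → refl ; v3 → refl ; v4 → refl ; v5 → refl ; v6 → refl }
  }

D : Digraph 7
D = record
  { adj = λ x y → arcsH x y ∨ isArc45 x y
  ; loopless = λ { v0 → refl ; v1 → refl ; v2 → refl ; v3 → refl ; v4 → refl ; v5 → refl ; v6 → refl }
  }

H⊆D : SpanningSubdigraph H D
H⊆D x y x→y rewrite x→y = refl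

colouringH : ArcColouring 7 3
colouringH v1 v4 = v1
colouringH v2 v1 = v2
colouringH v2 v5 = v2
colouringH v3 v0 = v1
colouringH v3 v2 = v1
colouringH v5 v1 = v2
colouringH v6 v2 = v1
colouringH v6 v3 = v2
colouringH _ _ = v0

colouringD : ArcColouring 7 4
colouringD v2 v1 = v1
colouringD v3 v0 = v2
colouringD v3 v2 = v2
colouringD v4 v5 = v2
colouringD v4 v6 = v3
colouringD v5 v1 = v1
colouringD v6 v2 = v2
colouringD _ _ = v0

colouringH-src : StronglyRainbowConnected H colouringH
colouringH-src =
  rainbowGeodesicsEverywhere⇒src H colouringH (from-yes (rainbowGeodesicsEverywhere? H colouringH))

colouringD-src : StronglyRainbowConnected D colouringD
colouringD-src =
  rainbowGeodesicsEverywhere⇒src D colouringD (from-yes (rainbowGeodesicsEverywhere? D colouringD))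

src-H≥3 : ∀ j (c : ArcColouring 7 j) → StronglyRainbowConnected H c → 3 ≤ j
src-H≥3 j c src = src⇒geodesic-len≤ H c src {w = w} (λ ()) (geodesics-geodesic H (here refl))
  where
  w : Walk H v2 v6
  w = cons {y = v1} refl (cons {y = v4} refl (cons refl nil))

src-D≥3 : ∀ j (c : ArcColouring 7 j) → StronglyRainbowConnected D c → 3 ≤ j
src-D≥3 j c src = src⇒geodesic-len≤ D c src {w = w} (λ ()) (geodesics-geodesic D (here refl))
  where
  w : Walk D v2 v6
  w = cons {y = v1} refl (cons {y = v4} refl (cons refl nil))

-- a_xy is the colour of the arc x → y; the hypotheses say that the geodesics of D from
-- 2 to 6, 5 to 6, 1 to 5, 4 to 1, 0 to 5, 4 to 2, 4 to 0 and 6 to 4 are rainbow.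
three-colours-insufficient : {a21 a14 a46 a51 a45 a04 a62 a63 a30 : Fin 3} →
  Unique (a21 ∷ a14 ∷ a46 ∷ []) → Unique (a51 ∷ a14 ∷ a46 ∷ []) →
  Unique (a14 ∷ a45 ∷ []) → Unique (a45 ∷ a51 ∷ []) → Unique (a04 ∷ a45 ∷ []) →
  Unique (a46 ∷ a62 ∷ []) → Unique (a46 ∷ a63 ∷ a30 ∷ []) →
  Unique (a62 ∷ a21 ∷ a14 ∷ []) ⊎ Unique (a63 ∷ a30 ∷ a04 ∷ []) → ⊥
three-colours-insufficient {a21} {a14} {a46} {a51} {a45} {a04} {a62} {a63} {a30}
  all-colours ((a51≢a14 ∷ a51≢a46 ∷ []) ∷ _) ((a14≢a45 ∷ []) ∷ _) ((a45≢a51 ∷ []) ∷ _)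
  ((a04≢a45 ∷ []) ∷ _) ((a46≢a62 ∷ []) ∷ _) rainbow40 rainbow64 = no-rainbow64 rainbow64
  where
  a51≡a21 : a51 ≡ a21
  a51≡a21 with unique-full⇒∈ all-colours refl a51
  ... | here eq = eq
  ... | there (here eq) = ⊥-elim (a51≢a14 eq)
  ... | there (there (here eq)) = ⊥-elim (a51≢a46 eq)

  a45≡a46 : a45 ≡ a46
  a45≡a46 with unique-full⇒∈ all-colours refl a45
  ... | here eq = ⊥-elim (a45≢a51 (trans eq (sym a51≡a21)))
  ... | there (here eq) = ⊥-elim (a14≢a45 (sym eq))
  ... | there (there (here eq)) = eq

  no-rainbow64 : Unique (a62 ∷ a21 ∷ a14 ∷ []) ⊎ Unique (a63 ∷ a30 ∷ a04 ∷ []) → ⊥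
  no-rainbow64 (inj₁ ((a62≢a21 ∷ a62≢a14 ∷ []) ∷ _)) with unique-full⇒∈ all-colours refl a62
  ... | here eq = a62≢a21 eq
  ... | there (here eq) = a62≢a14 eq
  ... | there (there (here eq)) = a46≢a62 (sym eq)
  no-rainbow64 (inj₂ ((_ ∷ a63≢a04 ∷ []) ∷ (a30≢a04 ∷ []) ∷ _)) with unique-full⇒∈ rainbow40 refl a04
  ... | here eq = a04≢a45 (trans eq (sym a45≡a46))
  ... | there (here eq) = a63≢a04 (sym eq)
  ... | there (there (here eq)) = a30≢a04 (sym eq)

src-D≢3 : (c : ArcColouring 7 3) → ¬ StronglyRainbowConnected D c
src-D≢3 c src = three-colours-insufficient
  (rainbow {v2} {v6} (λ ()) refl) (rainbow {v5} {v6} (λ ()) refl) (rainbow {v1} {v5} (λ ()) refl)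
  (rainbow {v4} {v1} (λ ()) refl) (rainbow {v0} {v5} (λ ()) refl) (rainbow {v4} {v2} (λ ()) refl)
  (rainbow {v4} {v0} (λ ()) refl) rainbow64
  where
  rainbow : ∀ {x y} {w : Walk D x y} → x ≢ y → geodesics D x y ≡ w ∷ [] → Rainbow c w
  rainbow = src⇒uniqueGeodesic-rainbow D c src

  rainbow64 : Unique (c v6 v2 ∷ c v2 v1 ∷ c v1 v4 ∷ []) ⊎ Unique (c v6 v3 ∷ c v3 v0 ∷ c v0 v4 ∷ [])
  rainbow64 with src⇒rainbowGeodesic D c src {v6} {v4} (λ ()) refl
  ... | here rainbow = inj₁ rainbow
  ... | there (here rainbow) = inj₂ rainbow

src-D≥4 : ∀ j (c : ArcColouring 7 j) → StronglyRainbowConnected D c → 4 ≤ j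
src-D≥4 j c src with m≤n⇒m<n∨m≡n (src-D≥3 j c src)
... | inj₁ 3<j = 3<j
... | inj₂ refl = ⊥-elim (src-D≢3 c src)

lemma1 : Σ ℕ (λ n → Σ (Digraph n) (λ D → Σ (Digraph n) (λ H →
           StronglyConnected D × StronglyConnected H × SpanningSubdigraph H D
           × Σ ℕ (λ kD → Σ ℕ (λ kH → IsSrc D kD × IsSrc H kH × kH < kD)))))
lemma1 =
  7 , D , H ,
  src⇒stronglyConnected D colouringD colouringD-src ,
  src⇒stronglyConnected H colouringH colouringH-src ,
  H⊆D ,
  4 , 3 ,
  ((colouringD , colouringD-src) , src-D≥4) ,
  ((colouringH , colouringH-src) , src-H≥3) ,
  ≤-refl
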